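{- Let $(G,e)\in\mathcal{G}'$ and let $G_0$ be the block of $G$ containing $e$. Then $(G_0,e)\in\mathcal{G}'$, and $H(G,e)$ is (isomorphic to) a disjoint union of some number of copies of $H(G_0,e)$.
   Context: Multigraphs may have loops and parallel edges. A series-parallel graph is a multigraph with no $K_4$ minor. $\mathcal{G}'$ is the set of pairs $(G,e)$ with $G$ a connected series-parallel multigraph and $e\in E(G)$ neither a bridge nor a loop. Blocks: every multigraph decomposes (via disjoint unions and gluing at single vertices) into loops, single edges, and $2$-connected multigraphs (at least two edges, no loops, connected after deleting any vertex); these pieces, which partition the edges, are the blocks. For $(G,e)\in\mathcal{G}'$, identify subsets of $E(G)\setminus\{e\}$ with vertices of $Q_{e(G)-1}$; $X(G/e)$ is the set of $S$ with $S\cup\{e\}$ a spanning tree of $G$, $X(G\setminus e)$ the set of $S$ that are spanning trees of $G$, and $H(G,e)$ is the induced subgraph of $Q_{e(G)-1}$ on $X(G/e)\cup X(G\setminus e)$. -}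

module Defs where

open import Data.Nat using (ℕ; _≤_)
open import Data.Fin using (Fin)
open import Data.Fin.Subset using (Subset; _∈_; _∉_; _⊆_; ⁅_⁆; _∪_; ∣_∣)
open import Data.Product using (Σ; ∃; ∃-syntax; _×_; _,_; proj₁; proj₂)
open import Data.Sum using (_⊎_)
open import Relation.Nullary using (¬_)
open import Data.Unit using (⊤)
open import Relation.Binary.PropositionalEquality using (_≡_; _≢_)

-- Finite multigraphs: vertices Fin nv, edges Fin ne, each edge has an
-- (ordered, but used unordered) pair of endpoints.  Loops (equal
-- endpoints) and parallel edges are allowed.

record Multigraph : Set where
  field
    nv   : ℕ
    ne   : ℕ
    ends : Fin ne → Fin nv × Fin nv
open Multigraph public

Joins : (G : Multigraph) → Fin (ne G) → Fin (nv G) → Fin (nv G) → Set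
Joins G f u v = (ends G f ≡ (u , v)) ⊎ (ends G f ≡ (v , u))

IsLoop : (G : Multigraph) → Fin (ne G) → Set
IsLoop G f = proj₁ (ends G f) ≡ proj₂ (ends G f)

Incident : (G : Multigraph) → Fin (ne G) → Fin (nv G) → Set
Incident G f v = (proj₁ (ends G f) ≡ v) ⊎ (proj₂ (ends G f) ≡ v)

data Reach (G : Multigraph) (P : Fin (ne G) → Set) : Fin (nv G) → Fin (nv G) → Set where
  here : ∀ {v} → Reach G P v v
  step : ∀ {u v w} (f : Fin (ne G)) → P f → Joins G f u v → Reach G P v w → Reach G P u w

SpanConnected : (G : Multigraph) → Subset (ne G) → Set
SpanConnected G S = ∀ u v → Reach G (λ f → f ∈ S) u v

Connected : (G : Multigraph) → Set
Connected G = ∀ u v → Reach G (λ _ → ⊤) u v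

-- e is a bridge: after deleting e its endpoints are disconnected
-- (equivalently, deleting e increases the number of components)
IsBridge : (G : Multigraph) → Fin (ne G) → Set
IsBridge G e = ¬ Reach G (λ f → f ≢ e) (proj₁ (ends G e)) (proj₂ (ends G e))

IsSpanningTree : (G : Multigraph) → Subset (ne G) → Set
IsSpanningTree G S =
  SpanConnected G S × (∀ f → f ∈ S → ¬ Reach G (λ g → g ∈ S × g ≢ f) (proj₁ (ends G f)) (proj₂ (ends G f)))
  -- the second component: removing any edge f of S disconnects its endpoints,
  -- i.e. S minus f is no longer connected (S contains no cycle, no loop)

HasK4Minor : (G : Multigraph) → Set
HasK4Minor G =
  Σ (Fin 4 → Subset (nv G)) λ B →
      (∀ i → ∃[ v ] v ∈ B i)
    × (∀ i j v → i ≢ j → v ∈ B i → v ∉ B j)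
    × (∀ i u v → u ∈ B i → v ∈ B i →
         Reach G (λ f → proj₁ (ends G f) ∈ B i × proj₂ (ends G f) ∈ B i) u v)
    × (∀ i j → i ≢ j → ∃[ f ] ((proj₁ (ends G f) ∈ B i × proj₂ (ends G f) ∈ B j)
                              ⊎ (proj₁ (ends G f) ∈ B j × proj₂ (ends G f) ∈ B i)))

SeriesParallel : Multigraph → Set
SeriesParallel G = ¬ HasK4Minor G

InG' : (G : Multigraph) → Fin (ne G) → Set
InG' G e = Connected G × SeriesParallel G × ¬ IsBridge G e × ¬ IsLoop G e

-- Blocks.  An edge set B spans the subgraph with edges B and vertices
-- the endpoints of edges of B.

InV : (G : Multigraph) → Subset (ne G) → Fin (nv G) → Set
InV G B v = ∃[ f ] (f ∈ B × Incident G f v)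

TwoConnected : (G : Multigraph) → Subset (ne G) → Set
TwoConnected G B =
    2 ≤ ∣ B ∣
  × (∀ f → f ∈ B → ¬ IsLoop G f)
  × (∀ u v → InV G B u → InV G B v → Reach G (λ f → f ∈ B) u v)
  × (∀ x u v → InV G B u → InV G B v → u ≢ x → v ≢ x →
       Reach G (λ f → f ∈ B × ¬ Incident G f x) u v)

BlockShaped : (G : Multigraph) → Subset (ne G) → Set
BlockShaped G B = (∃[ f ] B ≡ ⁅ f ⁆) ⊎ TwoConnected G B

IsBlock : (G : Multigraph) → Subset (ne G) → Set
IsBlock G B = BlockShaped G B × (∀ B′ → B ⊆ B′ → BlockShaped G B′ → B′ ≡ B)

-- G0 is (a presentation of) the sub-multigraph of G spanned by B,
-- via injective vertex map φ and edge map ψ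
IsSubgraphOn : (G : Multigraph) → Subset (ne G) → (G₀ : Multigraph) →
               (Fin (nv G₀) → Fin (nv G)) → (Fin (ne G₀) → Fin (ne G)) → Set
IsSubgraphOn G B G₀ φ ψ =
    (∀ x y → φ x ≡ φ y → x ≡ y)
  × (∀ f g → ψ f ≡ ψ g → f ≡ g)
  × (∀ f → ends G (ψ f) ≡ (φ (proj₁ (ends G₀ f)) , φ (proj₂ (ends G₀ f))))
  × (∀ f → f ∈ B → ∃[ f₀ ] ψ f₀ ≡ f)
  × (∀ f₀ → ψ f₀ ∈ B)
  × (∀ v → InV G B v → ∃[ v₀ ] φ v₀ ≡ v)
  × (∀ v₀ → InV G B (φ v₀))

-- The graph H(G,e): vertices of Q_{e(G)-1} are subsets of E(G) ∖ {e},
-- represented as subsets S of E(G) with e ∉ S.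

InH : (G : Multigraph) → Fin (ne G) → Subset (ne G) → Set
InH G e S = e ∉ S × (IsSpanningTree G (S ∪ ⁅ e ⁆) ⊎ IsSpanningTree G S)

CubeAdj : ∀ {m} → Subset m → Subset m → Set
CubeAdj {m} S T = ∃[ f ] ((f ∈ S → f ∉ T) × (f ∉ S → f ∈ T)
                          × (∀ g → g ≢ f → (g ∈ S → g ∈ T) × (g ∈ T → g ∈ S)))

-- H(G,e) is isomorphic to the disjoint union of k copies of H(G0,e0):
-- a bijection σ from the vertices of H(G,e) onto Fin k × V(H(G0,e0))
-- with S ~ T iff σ S, σ T lie in the same copy and are adjacent there.
IsoToCopies : (G : Multigraph) (e : Fin (ne G)) (k : ℕ)
              (G₀ : Multigraph) (e₀ : Fin (ne G₀)) → Set
IsoToCopies G e k G₀ e₀ =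
  Σ (Subset (ne G) → Fin k × Subset (ne G₀)) λ σ →
      (∀ S → InH G e S → InH G₀ e₀ (proj₂ (σ S)))
    × (∀ S T → InH G e S → InH G e T → σ S ≡ σ T → S ≡ T)
    × (∀ i T → InH G₀ e₀ T → ∃[ S ] (InH G e S × σ S ≡ (i , T)))
    × (∀ S T → InH G e S → InH G e T →
         (CubeAdj S T → (proj₁ (σ S) ≡ proj₁ (σ T) × CubeAdj (proj₂ (σ S)) (proj₂ (σ T))))
       × ((proj₁ (σ S) ≡ proj₁ (σ T) × CubeAdj (proj₂ (σ S)) (proj₂ (σ T))) → CubeAdj S T))

{-# OPTIONS --safe #-}
module Submission where

-- For a vertex w, let attach w be the vertex of the block B at which the piece of G ∖ B
-- containing w hangs: a B-free path between two distinct vertices of B would enlarge the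
-- block, so it is unique. A spanning tree Y of G then splits into a spanning tree of the
-- block (a spanning tree of G₀) and a pendant forest Y ∖ B: an acyclic set of edges outside B
-- joining every vertex to its attachment vertex; conversely any such pair glues to a spanning
-- tree of G. So S ↦ (S ∖ B, S ∩ B) is a bijection from H(G,e) onto (pendant forests) × H(G₀,e),
-- and as two pendant forests never differ in a single edge, every cube edge of H(G,e) flips an
-- edge of B, i.e. stays inside one copy of H(G₀,e).

open import Defs
open import Data.Bool using (Bool; true; false)
import Data.Bool.Properties as Bool
open import Data.Empty using (⊥-elim)
open import Data.Fin as Fin using (Fin; zero; suc; _≟_)
import Data.Fin.Properties as Fin
open import Data.Fin.Subset using (Subset; _∈_; _∉_; _⊆_; ⁅_⁆; _∪_; _─_; _-_; ∣_∣; inside; outside)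
  renaming (⊤ to full)
open import Data.Fin.Subset.Properties
  using (_∈?_; x∈⁅x⁆; x∈⁅y⁆⇒x≡y; ∣⁅x⁆∣≡1; p⊂q⇒∣p∣<∣q∣; ∈⊤; ⊆-antisym;
         x∈p∪q⁺; x∈p∪q⁻; x∈p∧x∉q⇒x∈p─q; p─q⊆p)
open import Data.List using (List; []; _∷_; length; lookup; map; _++_; filter; allFin)
open import Data.List.Membership.Propositional using () renaming (_∈_ to _∈ₗ_)
open import Data.List.Membership.Propositional.Properties
  using (∈-lookup; ∈-filter⁺; ∈-filter⁻; ∈-allFin; ∈-map⁺; ∈-map⁻; ∈-++⁺ˡ; ∈-++⁺ʳ)
open import Data.List.Relation.Unary.All as All using (All; []; _∷_)
open import Data.List.Relation.Unary.All.Properties.Core using (¬Any⇒All¬)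
open import Data.List.Relation.Unary.Any as Any using (here; there)
open import Data.List.Relation.Unary.Any.Properties using (lookup-index)
open import Data.List.Relation.Unary.AllPairs using ([]; _∷_)
open import Data.List.Relation.Unary.Unique.Propositional using (Unique)
import Data.List.Relation.Unary.Unique.Propositional.Properties as Unique
open import Data.Nat using (ℕ; zero; suc; _≤_; _<_; s≤s)
import Data.Nat.Properties as ℕ
open import Data.Product using (Σ; Σ-syntax; ∃; ∃-syntax; _×_; _,_; proj₁; proj₂; map₁)
open import Data.Product.Properties using (≡-dec)
open import Data.Sum using (_⊎_; inj₁; inj₂)
open import Data.Unit using (tt)
open import Data.Vec using ([]; _∷_; tabulate; here; there)
import Data.Vec.Properties as Vec
open import Function using (_∘_)
open import Relation.Nullary using (¬_; Dec; yes; no; does)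
open import Relation.Nullary.Decidable using (map′; dec-true; _×-dec_; _⊎-dec_; _→-dec_; ¬?)
open import Relation.Unary using (Decidable)
open import Relation.Binary.PropositionalEquality

lookup-injective : ∀ {A : Set} {xs : List A} → Unique xs →
                   ∀ {i j} → lookup xs i ≡ lookup xs j → i ≡ j
lookup-injective {xs = x ∷ xs} (x∉xs ∷ u) {zero}  {zero}  eq = refl
lookup-injective {xs = x ∷ xs} (x∉xs ∷ u) {zero}  {suc j} eq = ⊥-elim (All.lookup x∉xs (∈-lookup j) eq)
lookup-injective {xs = x ∷ xs} (x∉xs ∷ u) {suc i} {zero}  eq = ⊥-elim (All.lookup x∉xs (∈-lookup i) (sym eq))
lookup-injective {xs = x ∷ xs} (x∉xs ∷ u) {suc i} {suc j} eq = cong suc (lookup-injective u eq)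

length-unique≤ : ∀ {n} {xs : List (Fin n)} → Unique xs → length xs ≤ n
length-unique≤ u = Fin.injective⇒≤ (lookup-injective u)

2≤∣p∣ : ∀ {n} {x y : Fin n} {p : Subset n} → x ∈ p → y ∈ p → x ≢ y → 2 ≤ ∣ p ∣
2≤∣p∣ {x = x} {y} {p} x∈p y∈p x≢y =
  subst (_< ∣ p ∣) (∣⁅x⁆∣≡1 x) (p⊂q⇒∣p∣<∣q∣ (⁅x⁆⊆p , y , y∈p , λ y∈⁅x⁆ → x≢y (sym (x∈⁅y⁆⇒x≡y x y∈⁅x⁆))))
  where
  ⁅x⁆⊆p : ⁅ x ⁆ ⊆ p
  ⁅x⁆⊆p z∈⁅x⁆ = subst (_∈ p) (sym (x∈⁅y⁆⇒x≡y x z∈⁅x⁆)) x∈p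

subsets : ∀ n → List (Subset n)
subsets zero    = [] ∷ []
subsets (suc n) = map (inside ∷_) (subsets n) ++ map (outside ∷_) (subsets n)

∈-subsets : ∀ {n} (p : Subset n) → p ∈ₗ subsets n
∈-subsets []                  = here refl
∈-subsets (true ∷ p)          = ∈-++⁺ˡ (∈-map⁺ (inside ∷_) (∈-subsets p))
∈-subsets {suc n} (false ∷ p) = ∈-++⁺ʳ (map (inside ∷_) (subsets n)) (∈-map⁺ (outside ∷_) (∈-subsets p))

subsets-unique : ∀ n → Unique (subsets n)
subsets-unique zero    = [] ∷ []
subsets-unique (suc n) =
  Unique.++⁺ (Unique.map⁺ Vec.∷-injectiveʳ (subsets-unique n)) (Unique.map⁺ Vec.∷-injectiveʳ (subsets-unique n)) disjoint
  where
  disjoint : ∀ {p} → ¬ (p ∈ₗ map (inside ∷_) (subsets n) × p ∈ₗ map (outside ∷_) (subsets n))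
  disjoint (p∈ , p∈′) with ∈-map⁻ (inside ∷_) p∈ | ∈-map⁻ (outside ∷_) p∈′
  ... | _ , _ , refl | _ , _ , ()

_≟ₛ_ : ∀ {n} (p q : Subset n) → Dec (p ≡ q)
_≟ₛ_ = Vec.≡-dec Bool._≟_

x∈p─q⇒x∉q : ∀ {n} {p q : Subset n} {x} → x ∈ p ─ q → x ∉ q
x∈p─q⇒x∉q {p = _ ∷ _} {_ ∷ _} () here
x∈p─q⇒x∉q {p = _ ∷ p} {_ ∷ q} (there x∈) (there x∈q) = x∈p─q⇒x∉q {p = p} {q} x∈ x∈q

select : ∀ {n} {P : Fin n → Set} → Decidable P → Subset n
select P? = tabulate (λ x → does (P? x))

∈-select⁺ : ∀ {n} {P : Fin n → Set} (P? : Decidable P) {x} → P x → x ∈ select P?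
∈-select⁺ P? {x} px = Vec.lookup⇒[]= x _ (trans (Vec.lookup∘tabulate _ x) (dec-true (P? x) px))

∈-select⁻ : ∀ {n} {P : Fin n → Set} (P? : Decidable P) {x} → x ∈ select P? → P x
∈-select⁻ P? {x} x∈ with P? x | trans (sym (Vec.lookup∘tabulate (λ y → does (P? y)) x)) (Vec.[]=⇒lookup x∈)
... | yes px | _ = px
... | no _   | ()

preimage : ∀ {m n} → (Fin m → Fin n) → Subset n → Subset m
preimage h Y = select (λ x → h x ∈? Y)

image? : ∀ {m n} (h : Fin m → Fin n) (X : Subset m) → Decidable (λ y → ∃[ x ] (h x ≡ y × x ∈ X))
image? h X y = Fin.any? (λ x → (h x ≟ y) ×-dec (x ∈? X))

image : ∀ {m n} → (Fin m → Fin n) → Subset m → Subset n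
image h X = select (image? h X)

_∈ₗ?_ : ∀ {n} (x : Fin n) (xs : List (Fin n)) → Dec (x ∈ₗ xs)
x ∈ₗ? xs = Any.any? (x ≟_) xs

module _ {m n} (h : Fin m → Fin n) where

  ∈-preimage⁺ : ∀ {Y x} → h x ∈ Y → x ∈ preimage h Y
  ∈-preimage⁺ {Y} = ∈-select⁺ (λ x → h x ∈? Y)

  ∈-preimage⁻ : ∀ {Y x} → x ∈ preimage h Y → h x ∈ Y
  ∈-preimage⁻ {Y} = ∈-select⁻ (λ x → h x ∈? Y)

  ∈-image⁺ : ∀ {X x} → x ∈ X → h x ∈ image h X
  ∈-image⁺ {X} {x} x∈X = ∈-select⁺ (image? h X) (x , refl , x∈X)

  ∈-image⁻ : ∀ {X y} → y ∈ image h X → ∃[ x ] (h x ≡ y × x ∈ X)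
  ∈-image⁻ {X} = ∈-select⁻ (image? h X)

ClosesCycle : (G : Multigraph) → Subset (ne G) → Fin (ne G) → Set
ClosesCycle G S f = Reach G (λ g → g ∈ S × g ≢ f) (proj₁ (ends G f)) (proj₂ (ends G f))

Acyclic : (G : Multigraph) → Subset (ne G) → Set
Acyclic G S = ∀ f → f ∈ S → ¬ ClosesCycle G S f

module Walks (G : Multigraph) where
  private
    V : Set
    V = Fin (nv G)
    E : Set
    E = Fin (ne G)

  Joins-sym : ∀ {f u v} → Joins G f u v → Joins G f v u
  Joins-sym (inj₁ eq) = inj₂ eq
  Joins-sym (inj₂ eq) = inj₁ eq

  Joins-ends : ∀ f → Joins G f (proj₁ (ends G f)) (proj₂ (ends G f))
  Joins-ends f = inj₁ refl

  Joins⇒Incidentˡ : ∀ {f u v} → Joins G f u v → Incident G f u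
  Joins⇒Incidentˡ (inj₁ eq) = inj₁ (cong proj₁ eq)
  Joins⇒Incidentˡ (inj₂ eq) = inj₂ (cong proj₂ eq)

  Joins⇒Incidentʳ : ∀ {f u v} → Joins G f u v → Incident G f v
  Joins⇒Incidentʳ j = Joins⇒Incidentˡ (Joins-sym j)

  Incident⇒endpoint : ∀ {f u v x} → Joins G f u v → Incident G f x → x ≡ u ⊎ x ≡ v
  Incident⇒endpoint (inj₁ eq) (inj₁ i) = inj₁ (trans (sym i) (cong proj₁ eq))
  Incident⇒endpoint (inj₁ eq) (inj₂ i) = inj₂ (trans (sym i) (cong proj₂ eq))
  Incident⇒endpoint (inj₂ eq) (inj₁ i) = inj₂ (trans (sym i) (cong proj₁ eq))
  Incident⇒endpoint (inj₂ eq) (inj₂ i) = inj₁ (trans (sym i) (cong proj₂ eq))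

  Joins⇒¬Incident : ∀ {f u v x} → Joins G f u v → u ≢ x → v ≢ x → ¬ Incident G f x
  Joins⇒¬Incident j u≢x v≢x i with Incident⇒endpoint j i
  ... | inj₁ x≡u = u≢x (sym x≡u)
  ... | inj₂ x≡v = v≢x (sym x≡v)

  Incident-pair : ∀ {f a b} → Incident G f a → Incident G f b → a ≡ b ⊎ Joins G f a b
  Incident-pair (inj₁ ia) (inj₁ ib) = inj₁ (trans (sym ia) ib)
  Incident-pair (inj₁ ia) (inj₂ ib) = inj₂ (inj₁ (cong₂ _,_ ia ib))
  Incident-pair (inj₂ ia) (inj₁ ib) = inj₂ (inj₂ (cong₂ _,_ ib ia))
  Incident-pair (inj₂ ia) (inj₂ ib) = inj₁ (trans (sym ia) ib)

  Joins-loop : ∀ {f u v} → Joins G f u v → IsLoop G f → u ≡ v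
  Joins-loop (inj₁ eq) l = trans (sym (cong proj₁ eq)) (trans l (cong proj₂ eq))
  Joins-loop (inj₂ eq) l = sym (trans (sym (cong proj₁ eq)) (trans l (cong proj₂ eq)))

  Incident-loop : ∀ {f a b} → IsLoop G f → Incident G f a → Incident G f b → a ≡ b
  Incident-loop l ia ib with Incident-pair ia ib
  ... | inj₁ a≡b = a≡b
  ... | inj₂ j   = Joins-loop j l

  Incident? : ∀ f v → Dec (Incident G f v)
  Incident? f v = (proj₁ (ends G f) ≟ v) ⊎-dec (proj₂ (ends G f) ≟ v)

  Joins? : ∀ f u v → Dec (Joins G f u v)
  Joins? f u v = ≡-dec _≟_ _≟_ (ends G f) (u , v) ⊎-dec ≡-dec _≟_ _≟_ (ends G f) (v , u)

  edge-walk : ∀ {P : E → Set} {u v} f → P f → Joins G f u v → Reach G P u v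
  edge-walk f p j = step f p j here

  infixr 5 _◅◅_
  _◅◅_ : ∀ {P u v w} → Reach G P u v → Reach G P v w → Reach G P u w
  here          ◅◅ s = s
  step f p j r  ◅◅ s = step f p j (r ◅◅ s)

  reverse : ∀ {P u v} → Reach G P u v → Reach G P v u
  reverse here           = here
  reverse (step f p j r) = reverse r ◅◅ edge-walk f p (Joins-sym j)

  weaken : ∀ {P Q : E → Set} {u v} → (∀ f → P f → Q f) → Reach G P u v → Reach G Q u v
  weaken h here           = here
  weaken h (step f p j r) = step f (h f p) j (weaken h r)

  project : ∀ {P Q : E → Set} (π : V → V) →
            (∀ f u v → P f → Joins G f u v → π u ≡ π v ⊎ (Q f × Joins G f (π u) (π v))) →
            ∀ {u v} → Reach G P u v → Reach G (λ f → P f × Q f) (π u) (π v)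
  project π h here = here
  project {P} {Q} π h (step {u} {w} {v} f p j r) with h f u w p j
  ... | inj₁ πu≡πw    = subst (λ z → Reach G (λ f → P f × Q f) z (π v)) (sym πu≡πw) (project π h r)
  ... | inj₂ (q , j′) = step f (p , q) j′ (project π h r)

  vertices : ∀ {P u v} → Reach G P u v → List V
  vertices {v = v} here = v ∷ []
  vertices (step {u} f p j r) = u ∷ vertices r

  edges : ∀ {P u v} → Reach G P u v → List E
  edges here           = []
  edges (step f p j r) = f ∷ edges r

  IsPath : ∀ {P u v} → Reach G P u v → Set
  IsPath r = Unique (vertices r)

  start∈vertices : ∀ {P u v} (r : Reach G P u v) → u ∈ₗ vertices r
  start∈vertices here           = here refl
  start∈vertices (step f p j r) = here refl

  end∈vertices : ∀ {P u v} (r : Reach G P u v) → v ∈ₗ vertices r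
  end∈vertices here           = here refl
  end∈vertices (step f p j r) = there (end∈vertices r)

  private
    suffix-path : ∀ {P w v} (r : Reach G P w v) → IsPath r → ∀ {u} → u ∈ₗ vertices r →
                  Σ (Reach G P u v) IsPath
    suffix-path here           r-path       (here refl) = here , r-path
    suffix-path (step f p j r) r-path       (here refl) = step f p j r , r-path
    suffix-path (step f p j r) (_ ∷ r-path) (there u∈) = suffix-path r r-path u∈

  toPath : ∀ {P u v} → Reach G P u v → Σ (Reach G P u v) IsPath
  toPath here = here , [] ∷ []
  toPath (step {u} f p j r) with toPath r
  ... | r′ , r′-path with u ∈ₗ? vertices r′
  ...   | yes u∈ = suffix-path r′ r′-path u∈
  ...   | no u∉  = step f p j r′ , ¬Any⇒All¬ (vertices r′) u∉ ∷ r′-path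

  steps : ∀ {P u v} → Reach G P u v → ℕ
  steps here           = 0
  steps (step f p j r) = suc (steps r)

  length-vertices : ∀ {P u v} (r : Reach G P u v) → length (vertices r) ≡ suc (steps r)
  length-vertices here           = refl
  length-vertices (step f p j r) = cong suc (length-vertices r)

  module _ {P : E → Set} (P? : Decidable P) where
    private
      ReachIn : ℕ → V → V → Set
      ReachIn zero    u v = u ≡ v
      ReachIn (suc n) u v = u ≡ v ⊎ ∃[ f ] ∃[ w ] (P f × Joins G f u w × ReachIn n w v)

      reachIn? : ∀ n u v → Dec (ReachIn n u v)
      reachIn? zero    u v = u ≟ v
      reachIn? (suc n) u v =
        (u ≟ v) ⊎-dec Fin.any? (λ f → Fin.any? (λ w → P? f ×-dec Joins? f u w ×-dec reachIn? n w v))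

      toWalk : ∀ n {u v} → ReachIn n u v → Reach G P u v
      toWalk zero    refl                        = here
      toWalk (suc n) (inj₁ refl)                 = here
      toWalk (suc n) (inj₂ (f , w , p , j , r))  = step f p j (toWalk n r)

      fromWalk : ∀ {u v} (r : Reach G P u v) → ReachIn (steps r) u v
      fromWalk here           = refl
      fromWalk (step f p j r) = inj₂ (f , _ , p , j , fromWalk r)

      ReachIn-mono : ∀ m n {u v} → m ≤ n → ReachIn m u v → ReachIn n u v
      ReachIn-mono zero    zero    _         r           = r
      ReachIn-mono zero    (suc n) _         r           = inj₁ r
      ReachIn-mono (suc m) (suc n) _         (inj₁ r)    = inj₁ r
      ReachIn-mono (suc m) (suc n) (s≤s m≤n) (inj₂ (f , w , p , j , r)) =
        inj₂ (f , w , p , j , ReachIn-mono m n m≤n r)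

      -- A path visits each vertex once, so has fewer than nv G steps.
      fromPath : ∀ {u v} → Reach G P u v → ReachIn (nv G) u v
      fromPath r with toPath r
      ... | r′ , r′-path = ReachIn-mono (steps r′) (nv G)
              (ℕ.<⇒≤ (subst (_≤ nv G) (length-vertices r′) (length-unique≤ r′-path))) (fromWalk r′)

    reach? : ∀ u v → Dec (Reach G P u v)
    reach? u v = map′ (toWalk (nv G)) fromPath (reachIn? (nv G) u v)

  ClosesCycle? : ∀ S f → Dec (ClosesCycle G S f)
  ClosesCycle? S f = reach? (λ g → (g ∈? S) ×-dec ¬? (g ≟ f)) _ _

  Acyclic? : ∀ S → Dec (Acyclic G S)
  Acyclic? S = Fin.all? (λ f → (f ∈? S) →-dec ¬? (ClosesCycle? S f))

  Incident⇒∈vertices : ∀ {P u v a g} (q : Reach G P u v) → g ∈ₗ edges q → Incident G g a → a ∈ₗ vertices q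
  Incident⇒∈vertices (step f p j r) (here refl) i with Incident⇒endpoint j i
  ... | inj₁ refl = here refl
  ... | inj₂ refl = there (start∈vertices r)
  Incident⇒∈vertices (step f p j r) (there g∈) i = there (Incident⇒∈vertices r g∈ i)

  path-edge-not-loop : ∀ {P u v g} (q : Reach G P u v) → IsPath q → g ∈ₗ edges q → ¬ IsLoop G g
  path-edge-not-loop (step f p j r) (u∉ ∷ _) (here refl) l = All.lookup u∉ (start∈vertices r) (Joins-loop j l)
  path-edge-not-loop (step f p j r) (_ ∷ r-path) (there g∈) l = path-edge-not-loop r r-path g∈ l

  walk-to-start : ∀ {P u v a} (q : Reach G P u v) → a ∈ₗ vertices q → Reach G (_∈ₗ edges q) a u
  walk-to-start here           (here refl) = here
  walk-to-start (step f p j r) (here refl) = here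
  walk-to-start (step f p j r) (there a∈)  =
    weaken (λ _ → there) (walk-to-start r a∈) ◅◅ edge-walk f (here refl) (Joins-sym j)

  walk-to-end-avoiding : ∀ {P u v a x} (q : Reach G P u v) → ¬ x ∈ₗ vertices q → a ∈ₗ vertices q →
                         Reach G (λ g → g ∈ₗ edges q × ¬ Incident G g x) a v
  walk-to-end-avoiding here x∉ (here refl) = here
  walk-to-end-avoiding (step f p j r) x∉ (here refl) =
    step f (here refl , Joins⇒¬Incident j (λ eq → x∉ (here (sym eq)))
                                          (λ eq → x∉ (there (subst (_∈ₗ vertices r) eq (start∈vertices r)))))
      j (weaken (λ _ → map₁ there) (walk-to-end-avoiding r (x∉ ∘ there) (start∈vertices r)))
  walk-to-end-avoiding (step f p j r) x∉ (there a∈) =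
    weaken (λ _ → map₁ there) (walk-to-end-avoiding r (x∉ ∘ there) a∈)

  path-escape : ∀ {P u v a x} (q : Reach G P u v) → IsPath q → a ∈ₗ vertices q → a ≢ x →
                (u ≢ x × Reach G (λ g → g ∈ₗ edges q × ¬ Incident G g x) a u)
              ⊎ (v ≢ x × Reach G (λ g → g ∈ₗ edges q × ¬ Incident G g x) a v)
  path-escape here           _ (here refl) a≢x = inj₁ (a≢x , here)
  path-escape (step f p j r) _ (here refl) a≢x = inj₁ (a≢x , here)
  path-escape {u = u} {v} {x = x} (step f p j r) (u∉ ∷ r-path) (there a∈) a≢x with x ≟ u
  ... | yes refl = inj₂ (v≢x , weaken (λ _ → map₁ there) (walk-to-end-avoiding r x∉r a∈))
    where
    x∉r : ¬ x ∈ₗ vertices r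
    x∉r x∈ = All.lookup u∉ x∈ refl
    v≢x : v ≢ x
    v≢x eq = x∉r (subst (_∈ₗ vertices r) eq (end∈vertices r))
  ... | no x≢u with path-escape r r-path a∈ a≢x
  ...   | inj₁ (w≢x , ρ) = inj₁ (x≢u ∘ sym , (weaken (λ _ → map₁ there) ρ ◅◅
            edge-walk f (here refl , Joins⇒¬Incident (Joins-sym j) w≢x (x≢u ∘ sym)) (Joins-sym j)))
  ...   | inj₂ (v≢x , ρ) = inj₂ (v≢x , weaken (λ _ → map₁ there) ρ)

module BlockShape (G : Multigraph) {B : Subset (ne G)} where
  open Walks G

  private
    single-Incident : ∀ {f₁ a} → B ≡ ⁅ f₁ ⁆ → InV G B a → Incident G f₁ a
    single-Incident {f₁} B≡ (f , f∈ , i) = subst (λ g → Incident G g _) (x∈⁅y⁆⇒x≡y f₁ (subst (f ∈_) B≡ f∈)) i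

    single-∈ : ∀ {f₁} → B ≡ ⁅ f₁ ⁆ → f₁ ∈ B
    single-∈ {f₁} B≡ = subst (f₁ ∈_) (sym B≡) (x∈⁅x⁆ f₁)

  block-connected : BlockShaped G B → ∀ {a c} → InV G B a → InV G B c → Reach G (_∈ B) a c
  block-connected (inj₂ (_ , _ , connected , _)) {a} {c} a∈ c∈ = connected a c a∈ c∈
  block-connected (inj₁ (f₁ , B≡)) a∈ c∈ with Incident-pair (single-Incident B≡ a∈) (single-Incident B≡ c∈)
  ... | inj₁ refl = here
  ... | inj₂ j    = edge-walk f₁ (single-∈ B≡) j

  block-connected-avoiding : BlockShaped G B → ∀ {a c x} → InV G B a → InV G B c → a ≢ x → c ≢ x →
                             Reach G (λ f → f ∈ B × ¬ Incident G f x) a c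
  block-connected-avoiding (inj₂ (_ , _ , _ , avoiding)) {a} {c} {x} a∈ c∈ a≢x c≢x = avoiding x a c a∈ c∈ a≢x c≢x
  block-connected-avoiding (inj₁ (f₁ , B≡)) a∈ c∈ a≢x c≢x
    with Incident-pair (single-Incident B≡ a∈) (single-Incident B≡ c∈)
  ... | inj₁ refl = here
  ... | inj₂ j    = edge-walk f₁ (single-∈ B≡ , Joins⇒¬Incident j a≢x c≢x) j

  block-loop⇒single-vertex : BlockShaped G B → ∀ {f a c} → f ∈ B → IsLoop G f → InV G B a → InV G B c → a ≡ c
  block-loop⇒single-vertex (inj₂ (_ , no-loop , _)) {f} f∈ l a∈ c∈ = ⊥-elim (no-loop f f∈ l)
  block-loop⇒single-vertex (inj₁ (f₁ , B≡)) {f} f∈ l a∈ c∈ =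
    Incident-loop (subst (IsLoop G) (x∈⁅y⁆⇒x≡y f₁ (subst (f ∈_) B≡ f∈)) l)
                  (single-Incident B≡ a∈) (single-Incident B≡ c∈)

module BlockMaximality (G : Multigraph) {B : Subset (ne G)} (isB : IsBlock G B) where
  open Walks G
  open BlockShape G

  private
    V : Set
    V = Fin (nv G)

    module Extension {u v} (u∈ : InV G B u) (v∈ : InV G B v) (u≢v : u ≢ v)
                     (q : Reach G (_∉ B) u v) (q-path : IsPath q)
                     {g} (g∈q : g ∈ₗ edges q) (g∉B : g ∉ B) where

      B′ : Subset (ne G)
      B′ = B ∪ select (_∈ₗ? edges q)

      B⊆B′ : B ⊆ B′
      B⊆B′ f∈ = x∈p∪q⁺ (inj₁ f∈)

      q⊆B′ : ∀ {f} → f ∈ₗ edges q → f ∈ B′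
      q⊆B′ f∈ = x∈p∪q⁺ (inj₂ (∈-select⁺ (_∈ₗ? edges q) f∈))

      B′-cases : ∀ {f} → f ∈ B′ → f ∈ B ⊎ f ∈ₗ edges q
      B′-cases f∈ with x∈p∪q⁻ B _ f∈
      ... | inj₁ f∈B = inj₁ f∈B
      ... | inj₂ f∈q = inj₂ (∈-select⁻ (_∈ₗ? edges q) f∈q)

      walk-to-u : ∀ {a} → InV G B′ a → Reach G (_∈ B′) a u
      walk-to-u (f , f∈ , i) with B′-cases f∈
      ... | inj₁ f∈B = weaken (λ _ → B⊆B′) (block-connected (proj₁ isB) (f , f∈B , i) u∈)
      ... | inj₂ f∈q = weaken (λ _ → q⊆B′) (walk-to-start q (Incident⇒∈vertices q f∈q i))

      block-vertex-≢ : ∀ x → Σ[ h ∈ V ] (InV G B h × h ≢ x)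
      block-vertex-≢ x with u ≟ x
      ... | yes refl = v , v∈ , u≢v ∘ sym
      ... | no u≢x   = u , u∈ , u≢x

      walk-to-B-avoiding : ∀ {a x} → InV G B′ a → a ≢ x →
                           Σ[ h ∈ V ] (InV G B h × h ≢ x × Reach G (λ f → f ∈ B′ × ¬ Incident G f x) a h)
      walk-to-B-avoiding {x = x} (f , f∈ , i) a≢x with B′-cases f∈
      ... | inj₁ f∈B with block-vertex-≢ x
      ...   | h , h∈ , h≢x = h , h∈ , h≢x ,
                weaken (λ _ → map₁ B⊆B′) (block-connected-avoiding (proj₁ isB) (f , f∈B , i) h∈ a≢x h≢x)
      walk-to-B-avoiding (f , f∈ , i) a≢x | inj₂ f∈q
        with path-escape q q-path (Incident⇒∈vertices q f∈q i) a≢x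
      ... | inj₁ (u≢x , ρ) = u , u∈ , u≢x , weaken (λ _ → map₁ q⊆B′) ρ
      ... | inj₂ (v≢x , ρ) = v , v∈ , v≢x , weaken (λ _ → map₁ q⊆B′) ρ

      twoConnected : TwoConnected G B′
      twoConnected = two-edges , no-loop , connected , avoiding
        where
        two-edges : 2 ≤ ∣ B′ ∣
        two-edges = 2≤∣p∣ (B⊆B′ (proj₁ (proj₂ u∈))) (q⊆B′ g∈q) (λ f≡g → g∉B (subst (_∈ B) f≡g (proj₁ (proj₂ u∈))))
        no-loop : ∀ f → f ∈ B′ → ¬ IsLoop G f
        no-loop f f∈ with B′-cases f∈
        ... | inj₁ f∈B = λ l → u≢v (block-loop⇒single-vertex (proj₁ isB) f∈B l u∈ v∈)
        ... | inj₂ f∈q = path-edge-not-loop q q-path f∈q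
        connected : ∀ a c → InV G B′ a → InV G B′ c → Reach G (_∈ B′) a c
        connected a c a∈ c∈ = walk-to-u a∈ ◅◅ reverse (walk-to-u c∈)
        avoiding : ∀ x a c → InV G B′ a → InV G B′ c → a ≢ x → c ≢ x →
                   Reach G (λ f → f ∈ B′ × ¬ Incident G f x) a c
        avoiding x a c a∈ c∈ a≢x c≢x with walk-to-B-avoiding a∈ a≢x | walk-to-B-avoiding c∈ c≢x
        ... | h₁ , h₁∈ , h₁≢x , ρ₁ | h₂ , h₂∈ , h₂≢x , ρ₂ =
          ρ₁ ◅◅ weaken (λ _ → map₁ B⊆B′) (block-connected-avoiding (proj₁ isB) h₁∈ h₂∈ h₁≢x h₂≢x) ◅◅ reverse ρ₂

  -- A path outside B between two distinct vertices of B would extend B to a larger 2-connected set.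
  outside-walk-trivial : ∀ {u v} → InV G B u → InV G B v → Reach G (_∉ B) u v → u ≡ v
  outside-walk-trivial {u} {v} u∈ v∈ r with u ≟ v
  ... | yes u≡v = u≡v
  ... | no u≢v with toPath r
  ...   | here , _ = ⊥-elim (u≢v refl)
  ...   | q@(step g g∉B _ _) , q-path = ⊥-elim (g∉B (subst (g ∈_) B′≡B (q⊆B′ (here refl))))
    where
    open Extension u∈ v∈ u≢v q q-path (here refl) g∉B
    B′≡B : B′ ≡ B
    B′≡B = proj₂ isB B′ B⊆B′ (inj₂ twoConnected)

module SpanningTreeExistence (G : Multigraph) where
  open Walks G

  private
    E : Set
    E = Fin (ne G)

    x∈p-y⁺ : ∀ {S : Subset (ne G)} {f g} → g ∈ S → g ≢ f → g ∈ S - f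
    x∈p-y⁺ {f = f} g∈ g≢f = x∈p∧x∉q⇒x∈p─q g∈ (λ g∈⁅f⁆ → g≢f (x∈⁅y⁆⇒x≡y f g∈⁅f⁆))

    x∈p-y⁻ : ∀ {S : Subset (ne G)} {f g} → g ∈ S - f → g ∈ S × g ≢ f
    x∈p-y⁻ {S} {f} g∈ = p─q⊆p S ⁅ f ⁆ g∈ , λ { refl → x∈p─q⇒x∉q {p = S} g∈ (x∈⁅x⁆ f) }

  ∈×ClosesCycle? : ∀ S f → Dec (f ∈ S × ClosesCycle G S f)
  ∈×ClosesCycle? S f = (f ∈? S) ×-dec ClosesCycle? S f

  around : ∀ {S f u v} → ClosesCycle G S f → Joins G f u v → Reach G (_∈ S - f) u v
  around cycle (inj₁ eq) = subst₂ (Reach G _) (cong proj₁ eq) (cong proj₂ eq)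
                             (weaken (λ _ (g∈ , g≢f) → x∈p-y⁺ g∈ g≢f) cycle)
  around cycle (inj₂ eq) = reverse (around cycle (inj₁ eq))

  -- Replace each use of f by the rest of the cycle it closes.
  bypass : ∀ {S f a b} → Reach G (_∈ S) a b → ClosesCycle G S f → Reach G (_∈ S - f) a b
  bypass here _ = here
  bypass {S} {f} (step g g∈ j r) cycle with g ≟ f
  ... | no g≢f   = step g (x∈p-y⁺ g∈ g≢f) j (bypass r cycle)
  ... | yes refl = around cycle j ◅◅ bypass r cycle

  prune : ∀ S f → Dec (f ∈ S × ClosesCycle G S f) → Subset (ne G)
  prune S f (yes _) = S - f
  prune S f (no _)  = S

  prune⊆ : ∀ S f d {g} → g ∈ prune S f d → g ∈ S
  prune⊆ S f (yes _) g∈ = proj₁ (x∈p-y⁻ g∈)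
  prune⊆ S f (no _)  g∈ = g∈

  prune-spans : ∀ S f d → SpanConnected G S → SpanConnected G (prune S f d)
  prune-spans S f (yes (_ , cycle)) spans u v = bypass (spans u v) cycle
  prune-spans S f (no _)            spans     = spans

  prune-breaks : ∀ S f d {T} → (∀ {g} → g ∈ T → g ∈ prune S f d) → f ∈ T → ¬ ClosesCycle G T f
  prune-breaks S f (yes _) T⊆ f∈ _     = proj₂ (x∈p-y⁻ (T⊆ f∈)) refl
  prune-breaks S f (no ¬c) T⊆ f∈ cycle = ¬c (T⊆ f∈ , weaken (λ _ (g∈ , g≢f) → T⊆ g∈ , g≢f) cycle)

  prune-all : Subset (ne G) → List E → Subset (ne G)
  prune-all S []       = S
  prune-all S (f ∷ fs) = prune-all (prune S f (∈×ClosesCycle? S f)) fs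

  prune-all⊆ : ∀ S fs {g} → g ∈ prune-all S fs → g ∈ S
  prune-all⊆ S []       g∈ = g∈
  prune-all⊆ S (f ∷ fs) g∈ = prune⊆ S f (∈×ClosesCycle? S f) (prune-all⊆ _ fs g∈)

  prune-all-spans : ∀ S fs → SpanConnected G S → SpanConnected G (prune-all S fs)
  prune-all-spans S []       spans = spans
  prune-all-spans S (f ∷ fs) spans = prune-all-spans _ fs (prune-spans S f (∈×ClosesCycle? S f) spans)

  prune-all-breaks : ∀ S fs {f} → f ∈ₗ fs → f ∈ prune-all S fs → ¬ ClosesCycle G (prune-all S fs) f
  prune-all-breaks S (f ∷ fs) (here refl) = prune-breaks S f (∈×ClosesCycle? S f) (prune-all⊆ _ fs)
  prune-all-breaks S (g ∷ fs) (there f∈)  = prune-all-breaks _ fs f∈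

  spanningTree-exists : Connected G → ∃[ T ] IsSpanningTree G T
  spanningTree-exists connected =
    prune-all full (allFin (ne G)) ,
    prune-all-spans full (allFin (ne G)) (λ u v → weaken (λ _ _ → ∈⊤) (connected u v)) ,
    λ f → prune-all-breaks full (allFin (ne G)) (∈-allFin f)

module Attachment (G : Multigraph) {B : Subset (ne G)} (isB : IsBlock G B)
                  (connected : Connected G) {r : Fin (nv G)} (r∈B : InV G B r) where
  open Walks G
  open BlockMaximality G isB
  open SpanningTreeExistence G using (spanningTree-exists)

  private
    V : Set
    V = Fin (nv G)
    E : Set
    E = Fin (ne G)

  InV? : ∀ v → Dec (InV G B v)
  InV? v = Fin.any? (λ f → (f ∈? B) ×-dec Incident? f v)

  Joins⇒InVˡ : ∀ {g u v} → g ∈ B → Joins G g u v → InV G B u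
  Joins⇒InVˡ {g} g∈ j = g , g∈ , Joins⇒Incidentˡ j

  Joins⇒InVʳ : ∀ {g u v} → g ∈ B → Joins G g u v → InV G B v
  Joins⇒InVʳ {g} g∈ j = g , g∈ , Joins⇒Incidentʳ j

  first-block-vertex : ∀ {Q : E → Set} {w t} → Reach G Q w t → InV G B t →
                       Σ[ t′ ∈ V ] (InV G B t′ × Reach G (λ f → Q f × f ∉ B) w t′)
  first-block-vertex {w = w} ρ t∈ with InV? w
  ... | yes w∈ = w , w∈ , here
  first-block-vertex here           t∈ | no w∉ = ⊥-elim (w∉ t∈)
  first-block-vertex (step f q j ρ) t∈ | no w∉ with first-block-vertex ρ t∈
  ... | t′ , t′∈ , ρ′ = t′ , t′∈ , step f (q , λ f∈ → w∉ (Joins⇒InVˡ f∈ j)) j ρ′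

  attach : V → V
  attach w = proj₁ (first-block-vertex (connected w r) r∈B)

  attach∈B : ∀ w → InV G B (attach w)
  attach∈B w = proj₁ (proj₂ (first-block-vertex (connected w r) r∈B))

  walk-to-attach : ∀ w → Reach G (_∉ B) w (attach w)
  walk-to-attach w = weaken (λ _ → proj₂) (proj₂ (proj₂ (first-block-vertex (connected w r) r∈B)))

  attach-unique : ∀ {w t} → Reach G (_∉ B) w t → InV G B t → t ≡ attach w
  attach-unique ρ t∈ = outside-walk-trivial t∈ (attach∈B _) (reverse ρ ◅◅ walk-to-attach _)

  attach-fixes-B : ∀ {w} → InV G B w → attach w ≡ w
  attach-fixes-B w∈ = sym (attach-unique here w∈)

  attach-outside-edge : ∀ {g u v} → g ∉ B → Joins G g u v → attach u ≡ attach v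
  attach-outside-edge g∉ j = sym (attach-unique (edge-walk _ g∉ j ◅◅ walk-to-attach _) (attach∈B _))

  walk-to-block : ∀ {P : E → Set} {u v} → Reach G P u v → Reach G (λ f → P f × f ∈ B) (attach u) (attach v)
  walk-to-block = project attach (λ f u v _ → keep-or-collapse f u v)
    where
    keep-or-collapse : ∀ f u v → Joins G f u v → attach u ≡ attach v ⊎ (f ∈ B × Joins G f (attach u) (attach v))
    keep-or-collapse f u v j with f ∈? B
    ... | yes f∈ = inj₂ (f∈ , subst₂ (Joins G f) (sym (attach-fixes-B (Joins⇒InVˡ f∈ j)))
                                                  (sym (attach-fixes-B (Joins⇒InVʳ f∈ j))) j)
    ... | no f∉  = inj₁ (attach-outside-edge f∉ j)

  walk-within-block : ∀ {P : E → Set} {u v} → InV G B u → InV G B v → Reach G P u v →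
                      Reach G (λ f → P f × f ∈ B) u v
  walk-within-block u∈ v∈ ρ = subst₂ (Reach G _) (attach-fixes-B u∈) (attach-fixes-B v∈) (walk-to-block ρ)

  -- Projecting along π keeps exactly the edges of the piece attached at c.
  private
    module Piece (c : V) where
      π : V → V
      π w with attach w ≟ c
      ... | yes _ = w
      ... | no _  = c

      π-inside : ∀ {w} → attach w ≡ c → π w ≡ w
      π-inside {w} eq with attach w ≟ c
      ... | yes _  = refl
      ... | no neq = ⊥-elim (neq eq)

      π-outside : ∀ {w} → attach w ≢ c → π w ≡ c
      π-outside {w} neq with attach w ≟ c
      ... | yes eq = ⊥-elim (neq eq)
      ... | no _   = refl

      π-B : ∀ {w} → InV G B w → π w ≡ c
      π-B {w} w∈ with attach w ≟ c
      ... | yes eq = trans (sym (attach-fixes-B w∈)) eq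
      ... | no _   = refl

      outside-edge : ∀ {f u v} → f ∉ B → Joins G f u v → Dec (attach u ≡ c) →
                     π u ≡ π v ⊎ (f ∉ B × Joins G f (π u) (π v))
      outside-edge {f} f∉ j (yes u↦c) =
        inj₂ (f∉ , subst₂ (Joins G f) (sym (π-inside u↦c)) (sym (π-inside (trans (sym (attach-outside-edge f∉ j)) u↦c))) j)
      outside-edge f∉ j (no u↛c) =
        inj₁ (trans (π-outside u↛c) (sym (π-outside (λ v↦c → u↛c (trans (attach-outside-edge f∉ j) v↦c)))))

      keep-or-collapse : ∀ f u v → Joins G f u v → π u ≡ π v ⊎ (f ∉ B × Joins G f (π u) (π v))
      keep-or-collapse f u v j with f ∈? B
      ... | yes f∈ = inj₁ (trans (π-B (Joins⇒InVˡ f∈ j)) (sym (π-B (Joins⇒InVʳ f∈ j))))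
      ... | no f∉  = outside-edge f∉ j (attach u ≟ c)

  walk-within-piece : ∀ {P : E → Set} {u v} → Reach G P u v → attach u ≡ attach v →
                      Reach G (λ f → P f × f ∉ B) u v
  walk-within-piece {u = u} ρ u~v =
    subst₂ (Reach G _) (π-inside refl) (π-inside (sym u~v)) (project π (λ f u v _ → keep-or-collapse f u v) ρ)
    where open Piece (attach u)

  IsPendantForest : Subset (ne G) → Set
  IsPendantForest X = (∀ f → f ∈ X → f ∉ B) × (∀ u → Reach G (_∈ X) u (attach u)) × Acyclic G X

  SpansBlock : Subset (ne G) → Set
  SpansBlock Y = ∀ u v → InV G B u → InV G B v → Reach G (λ f → f ∈ Y × f ∈ B) u v

  AcyclicInBlock : Subset (ne G) → Set
  AcyclicInBlock Y =
    ∀ f → f ∈ Y → f ∈ B → ¬ Reach G (λ g → (g ∈ Y × g ∈ B) × g ≢ f) (proj₁ (ends G f)) (proj₂ (ends G f))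

  IsBlockSpanningTree : Subset (ne G) → Set
  IsBlockSpanningTree Y = SpansBlock Y × AcyclicInBlock Y

  spanningTree-split : ∀ {Y} → IsSpanningTree G Y → IsBlockSpanningTree Y × IsPendantForest (Y ─ B)
  spanningTree-split {Y} (spans , acyclic) = (block-spans , block-acyclic) , (outside-B , to-attach , pendant-acyclic)
    where
    block-spans : SpansBlock Y
    block-spans u v u∈ v∈ = walk-within-block u∈ v∈ (spans u v)
    block-acyclic : AcyclicInBlock Y
    block-acyclic f f∈Y _ cycle = acyclic f f∈Y (weaken (λ _ → map₁ proj₁) cycle)
    outside-B : ∀ f → f ∈ Y ─ B → f ∉ B
    outside-B f = x∈p─q⇒x∉q
    to-attach : ∀ u → Reach G (_∈ Y ─ B) u (attach u)
    to-attach u with first-block-vertex (spans u (attach u)) (attach∈B u)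
    ... | t , t∈ , ρ = subst (Reach G _ u) (attach-unique (weaken (λ _ → proj₂) ρ) t∈)
                             (weaken (λ _ (f∈Y , f∉B) → x∈p∧x∉q⇒x∈p─q f∈Y f∉B) ρ)
    pendant-acyclic : Acyclic G (Y ─ B)
    pendant-acyclic f f∈ cycle = acyclic f (p─q⊆p _ _ f∈) (weaken (λ _ → map₁ (p─q⊆p _ _)) cycle)

  spanningTree-glue : ∀ {Y} → IsBlockSpanningTree Y → IsPendantForest (Y ─ B) → IsSpanningTree G Y
  spanningTree-glue {Y} (block-spans , block-acyclic) (_ , to-attach , pendant-acyclic) = spans , acyclic
    where
    into-Y : ∀ {u v} → Reach G (_∈ Y ─ B) u v → Reach G (_∈ Y) u v
    into-Y = weaken (λ _ → p─q⊆p _ _)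
    spans : SpanConnected G Y
    spans u v = into-Y (to-attach u)
             ◅◅ weaken (λ _ → proj₁) (block-spans (attach u) (attach v) (attach∈B u) (attach∈B v))
             ◅◅ reverse (into-Y (to-attach v))
    -- A cycle through f stays in the block if f ∈ B, and in the piece of f otherwise.
    acyclic : Acyclic G Y
    acyclic f f∈Y cycle with f ∈? B
    ... | yes f∈B = block-acyclic f f∈Y f∈B
          (weaken (λ _ ((g∈Y , g≢f) , g∈B) → (g∈Y , g∈B) , g≢f)
            (walk-within-block (Joins⇒InVˡ f∈B (Joins-ends f)) (Joins⇒InVʳ f∈B (Joins-ends f)) cycle))
    ... | no f∉B = pendant-acyclic f (x∈p∧x∉q⇒x∈p─q f∈Y f∉B)
          (weaken (λ _ ((g∈Y , g≢f) , g∉B) → x∈p∧x∉q⇒x∈p─q g∈Y g∉B , g≢f)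
            (walk-within-piece cycle (attach-outside-edge f∉B (Joins-ends f))))

  IsPendantForest? : Decidable IsPendantForest
  IsPendantForest? X = Fin.all? (λ f → (f ∈? X) →-dec ¬? (f ∈? B))
                 ×-dec Fin.all? (λ u → reach? (_∈? X) u (attach u))
                 ×-dec Acyclic? X

  pendantForests : List (Subset (ne G))
  pendantForests = filter IsPendantForest? (subsets (ne G))

  pendantForestCount : ℕ
  pendantForestCount = length pendantForests

  ∈-pendantForests : ∀ {X} → IsPendantForest X → X ∈ₗ pendantForests
  ∈-pendantForests forest = ∈-filter⁺ IsPendantForest? (∈-subsets _) forest

  lookup-pendantForests : ∀ i → IsPendantForest (lookup pendantForests i)
  lookup-pendantForests i = proj₂ (∈-filter⁻ IsPendantForest? {xs = subsets (ne G)} (∈-lookup i))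

  pendantForests-unique : Unique pendantForests
  pendantForests-unique = Unique.filter⁺ IsPendantForest? (subsets-unique (ne G))

  -- Junk value outside pendant forests; one exists because G has a spanning tree.
  forestIndex : Subset (ne G) → Fin pendantForestCount
  forestIndex X with Any.any? (X ≟ₛ_) pendantForests
  ... | yes X∈ = Any.index X∈
  ... | no _   = Any.index (∈-pendantForests (proj₂ (spanningTree-split (proj₂ (spanningTree-exists connected)))))

  lookup-forestIndex : ∀ {X} → IsPendantForest X → lookup pendantForests (forestIndex X) ≡ X
  lookup-forestIndex {X} forest with Any.any? (X ≟ₛ_) pendantForests
  ... | yes X∈ = sym (lookup-index X∈)
  ... | no X∉  = ⊥-elim (X∉ (∈-pendantForests forest))

  forestIndex-lookup : ∀ i → forestIndex (lookup pendantForests i) ≡ i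
  forestIndex-lookup i = lookup-injective pendantForests-unique (lookup-forestIndex (lookup-pendantForests i))

  forestIndex-injective : ∀ {X Y} → IsPendantForest X → IsPendantForest Y → forestIndex X ≡ forestIndex Y → X ≡ Y
  forestIndex-injective {X} {Y} forestX forestY eq = begin
    X                                      ≡⟨ lookup-forestIndex forestX ⟨
    lookup pendantForests (forestIndex X)  ≡⟨ cong (lookup pendantForests) eq ⟩
    lookup pendantForests (forestIndex Y)  ≡⟨ lookup-forestIndex forestY ⟩
    Y                                      ∎
    where open ≡-Reasoning

  -- Both ends of f reach their common attachment within Y, so f would close a cycle in X.
  pendantForest-minimal : ∀ {X Y f} → IsPendantForest X → IsPendantForest Y → f ∈ X →
                          ¬ (∀ {g} → g ∈ Y → g ∈ X × g ≢ f)
  pendantForest-minimal {f = f} (outside-X , _ , acyclic-X) (_ , to-attach-Y , _) f∈X Y⊆X-f =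
    acyclic-X f f∈X (weaken (λ _ → Y⊆X-f)
      (to-attach-Y _ ◅◅ subst (λ z → Reach G _ z _) (sym (attach-outside-edge (outside-X f f∈X) (Joins-ends f)))
                                  (reverse (to-attach-Y _))))

  ∈-off-B : ∀ {S T g} → S ─ B ≡ T ─ B → g ∉ B → g ∈ S → g ∈ T
  ∈-off-B {S} {T} {g} eq g∉B g∈S = p─q⊆p T B (subst (g ∈_) eq (x∈p∧x∉q⇒x∈p─q g∈S g∉B))

  ─B-agree : ∀ {S T} → (∀ g → g ∉ B → g ∈ S → g ∈ T) → (∀ g → g ∉ B → g ∈ T → g ∈ S) → S ─ B ≡ T ─ B
  ─B-agree S⊆T T⊆S = ⊆-antisym
    (λ g∈ → x∈p∧x∉q⇒x∈p─q (S⊆T _ (x∈p─q⇒x∉q g∈) (p─q⊆p _ B g∈)) (x∈p─q⇒x∉q g∈))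
    (λ g∈ → x∈p∧x∉q⇒x∈p─q (T⊆S _ (x∈p─q⇒x∉q g∈) (p─q⊆p _ B g∈)) (x∈p─q⇒x∉q g∈))

  flip-off-B-impossible : ∀ {S T f} → IsPendantForest (S ─ B) → IsPendantForest (T ─ B) →
                          f ∉ B → f ∈ S → f ∉ T → ¬ (∀ g → g ≢ f → g ∈ T → g ∈ S)
  flip-off-B-impossible {S} {T} {f} forest-S forest-T f∉B f∈S f∉T T⊆S =
    pendantForest-minimal forest-S forest-T (x∈p∧x∉q⇒x∈p─q f∈S f∉B) T─B⊆S─B-f
    where
    T─B⊆S─B-f : ∀ {g} → g ∈ T ─ B → g ∈ S ─ B × g ≢ f
    T─B⊆S─B-f {g} g∈ = x∈p∧x∉q⇒x∈p─q (T⊆S g g≢f (p─q⊆p T B g∈)) (x∈p─q⇒x∉q g∈) , g≢f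
      where
      g≢f : g ≢ f
      g≢f g≡f = f∉T (subst (_∈ T) g≡f (p─q⊆p T B g∈))

  CubeAdj-off-B-impossible : ∀ {S T f} → IsPendantForest (S ─ B) → IsPendantForest (T ─ B) → f ∉ B →
                             (f ∈ S → f ∉ T) → (f ∉ S → f ∈ T) →
                             ¬ (∀ g → g ≢ f → (g ∈ S → g ∈ T) × (g ∈ T → g ∈ S))
  CubeAdj-off-B-impossible {S} {f = f} forest-S forest-T f∉B S→T ¬S→T agree with f ∈? S
  ... | yes f∈S = flip-off-B-impossible forest-S forest-T f∉B f∈S (S→T f∈S) (λ g g≢f → proj₂ (agree g g≢f))
  ... | no f∉S  = flip-off-B-impossible forest-T forest-S f∉B (¬S→T f∉S) f∉S (λ g g≢f → proj₁ (agree g g≢f))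

module Homomorphism (G₀ G : Multigraph) (φ : Fin (nv G₀) → Fin (nv G)) (ψ : Fin (ne G₀) → Fin (ne G))
                    (ends-ψ : ∀ f → ends G (ψ f) ≡ (φ (proj₁ (ends G₀ f)) , φ (proj₂ (ends G₀ f)))) where

  map-Joins : ∀ {f u v} → Joins G₀ f u v → Joins G (ψ f) (φ u) (φ v)
  map-Joins {f} (inj₁ eq) = inj₁ (trans (ends-ψ f) (cong (λ z → φ (proj₁ z) , φ (proj₂ z)) eq))
  map-Joins {f} (inj₂ eq) = inj₂ (trans (ends-ψ f) (cong (λ z → φ (proj₁ z) , φ (proj₂ z)) eq))

  map-walk : ∀ {P : Fin (ne G₀) → Set} {Q : Fin (ne G) → Set} → (∀ f → P f → Q (ψ f)) →
             ∀ {u v} → Reach G₀ P u v → Reach G Q (φ u) (φ v)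
  map-walk h here           = here
  map-walk h (step f p j r) = step (ψ f) (h f p) (map-Joins j) (map-walk h r)

  module _ (φ-injective : ∀ x y → φ x ≡ φ y → x ≡ y) where

    lift-Joins : ∀ {f₀ x w u₀} → Joins G (ψ f₀) x w → x ≡ φ u₀ → ∃[ w₀ ] (w ≡ φ w₀ × Joins G₀ f₀ u₀ w₀)
    lift-Joins {f₀} {x} {w} (inj₁ eq) x≡ =
      proj₂ (ends G₀ f₀) , sym (cong proj₂ ends≡) , inj₁ (cong₂ _,_ (φ-injective _ _ (trans (cong proj₁ ends≡) x≡)) refl)
      where
      ends≡ : (φ (proj₁ (ends G₀ f₀)) , φ (proj₂ (ends G₀ f₀))) ≡ (x , w)
      ends≡ = trans (sym (ends-ψ f₀)) eq
    lift-Joins {f₀} {x} {w} (inj₂ eq) x≡ =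
      proj₁ (ends G₀ f₀) , sym (cong proj₁ ends≡) , inj₂ (cong₂ _,_ refl (φ-injective _ _ (trans (cong proj₂ ends≡) x≡)))
      where
      ends≡ : (φ (proj₁ (ends G₀ f₀)) , φ (proj₂ (ends G₀ f₀))) ≡ (w , x)
      ends≡ = trans (sym (ends-ψ f₀)) eq

    lift-walk : ∀ {Q : Fin (ne G) → Set} → (∀ f → Q f → ∃[ f₀ ] ψ f₀ ≡ f) →
                ∀ {x y} → Reach G Q x y → ∀ {u₀ v₀} → x ≡ φ u₀ → y ≡ φ v₀ → Reach G₀ (Q ∘ ψ) u₀ v₀
    lift-walk in-image here {u₀} x≡ y≡ = subst (Reach G₀ _ u₀) (φ-injective _ _ (trans (sym x≡) y≡)) here
    lift-walk in-image (step f q j r) x≡ y≡ with in-image f q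
    ... | f₀ , refl with lift-Joins j x≡
    ...   | w₀ , w≡ , j₀ = step f₀ q j₀ (lift-walk in-image r w≡ y≡)

    K4-minor-image : HasK4Minor G₀ → HasK4Minor G
    K4-minor-image (branch , nonempty , disjoint , connected , adjacent) =
      branch′ , nonempty′ , disjoint′ , connected′ , adjacent′
      where
      branch′ : Fin 4 → Subset (nv G)
      branch′ i = image φ (branch i)
      end₁∈ : ∀ {i} f → proj₁ (ends G₀ f) ∈ branch i → proj₁ (ends G (ψ f)) ∈ branch′ i
      end₁∈ f x∈ = subst (_∈ _) (sym (cong proj₁ (ends-ψ f))) (∈-image⁺ φ x∈)
      end₂∈ : ∀ {i} f → proj₂ (ends G₀ f) ∈ branch i → proj₂ (ends G (ψ f)) ∈ branch′ i
      end₂∈ f y∈ = subst (_∈ _) (sym (cong proj₂ (ends-ψ f))) (∈-image⁺ φ y∈)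
      nonempty′ : ∀ i → ∃[ v ] v ∈ branch′ i
      nonempty′ i = φ (proj₁ (nonempty i)) , ∈-image⁺ φ (proj₂ (nonempty i))
      disjoint′ : ∀ i j v → i ≢ j → v ∈ branch′ i → v ∉ branch′ j
      disjoint′ i j v i≢j v∈i v∈j with ∈-image⁻ φ v∈i | ∈-image⁻ φ v∈j
      ... | a , refl , a∈ | b , φb≡φa , b∈ = disjoint i j a i≢j a∈ (subst (_∈ branch j) (φ-injective _ _ φb≡φa) b∈)
      connected′ : ∀ i u v → u ∈ branch′ i → v ∈ branch′ i →
                   Reach G (λ f → proj₁ (ends G f) ∈ branch′ i × proj₂ (ends G f) ∈ branch′ i) u v
      connected′ i u v u∈ v∈ with ∈-image⁻ φ u∈ | ∈-image⁻ φ v∈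
      ... | a , refl , a∈ | b , refl , b∈ =
        map-walk (λ f (x∈ , y∈) → end₁∈ f x∈ , end₂∈ f y∈) (connected i a b a∈ b∈)
      adjacent′ : ∀ i j → i ≢ j → ∃[ f ] ((proj₁ (ends G f) ∈ branch′ i × proj₂ (ends G f) ∈ branch′ j)
                                       ⊎ (proj₁ (ends G f) ∈ branch′ j × proj₂ (ends G f) ∈ branch′ i))
      adjacent′ i j i≢j with adjacent i j i≢j
      ... | f , inj₁ (x∈ , y∈) = ψ f , inj₁ (end₁∈ f x∈ , end₂∈ f y∈)
      ... | f , inj₂ (x∈ , y∈) = ψ f , inj₂ (end₁∈ f x∈ , end₂∈ f y∈)

module BlockPresentation (G : Multigraph) {e : Fin (ne G)} (inG′ : InG' G e)
                         {B : Subset (ne G)} (isB : IsBlock G B) (e∈B : e ∈ B)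
                         {G₀ : Multigraph} {φ : Fin (nv G₀) → Fin (nv G)} {ψ : Fin (ne G₀) → Fin (ne G)}
                         (sub : IsSubgraphOn G B G₀ φ ψ) where
  open Walks G
  open Attachment G isB (proj₁ inG′) {proj₁ (ends G e)} (e , e∈B , inj₁ refl) public

  private
    φ-injective : ∀ x y → φ x ≡ φ y → x ≡ y
    φ-injective = proj₁ sub
    ψ-injective : ∀ f g → ψ f ≡ ψ g → f ≡ g
    ψ-injective = proj₁ (proj₂ sub)
    ends-ψ : ∀ f → ends G (ψ f) ≡ (φ (proj₁ (ends G₀ f)) , φ (proj₂ (ends G₀ f)))
    ends-ψ = proj₁ (proj₂ (proj₂ sub))
    ψ-onto-B : ∀ f → f ∈ B → ∃[ f₀ ] ψ f₀ ≡ f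
    ψ-onto-B = proj₁ (proj₂ (proj₂ (proj₂ sub)))
    ψ∈B : ∀ f₀ → ψ f₀ ∈ B
    ψ∈B = proj₁ (proj₂ (proj₂ (proj₂ (proj₂ sub))))
    φ-onto-V : ∀ v → InV G B v → ∃[ v₀ ] φ v₀ ≡ v
    φ-onto-V = proj₁ (proj₂ (proj₂ (proj₂ (proj₂ (proj₂ sub)))))
    φ∈V : ∀ v₀ → InV G B (φ v₀)
    φ∈V = proj₂ (proj₂ (proj₂ (proj₂ (proj₂ (proj₂ sub)))))

  open Homomorphism G₀ G φ ψ ends-ψ
  open Walks G₀ using () renaming (weaken to weaken₀)

  lift-B-walk : ∀ {Q : Fin (ne G) → Set} → (∀ f → Q f → f ∈ B) →
                ∀ {x y} → Reach G Q x y → ∀ {u₀ v₀} → x ≡ φ u₀ → y ≡ φ v₀ → Reach G₀ (Q ∘ ψ) u₀ v₀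
  lift-B-walk Q⊆B = lift-walk φ-injective (λ f q → ψ-onto-B f (Q⊆B f q))

  blockSpanningTree⁺ : ∀ {Y} → IsSpanningTree G₀ (preimage ψ Y) → IsBlockSpanningTree Y
  blockSpanningTree⁺ {Y} (spans₀ , acyclic₀) = spans , acyclic
    where
    spans : SpansBlock Y
    spans u v u∈ v∈ with φ-onto-V u u∈ | φ-onto-V v v∈
    ... | u₀ , refl | v₀ , refl = map-walk (λ f₀ f₀∈ → ∈-preimage⁻ ψ f₀∈ , ψ∈B f₀) (spans₀ u₀ v₀)
    acyclic : AcyclicInBlock Y
    acyclic f f∈Y f∈B cycle with ψ-onto-B f f∈B
    ... | f₀ , refl = acyclic₀ f₀ (∈-preimage⁺ ψ f∈Y)
      (weaken₀ (λ g₀ ((g∈Y , _) , g≢f) → ∈-preimage⁺ ψ g∈Y , g≢f ∘ cong ψ)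
        (lift-B-walk (λ _ → proj₂ ∘ proj₁) cycle (cong proj₁ (ends-ψ f₀)) (cong proj₂ (ends-ψ f₀))))

  blockSpanningTree⁻ : ∀ {Y} → IsBlockSpanningTree Y → IsSpanningTree G₀ (preimage ψ Y)
  blockSpanningTree⁻ {Y} (spans , acyclic) = spans₀ , acyclic₀
    where
    spans₀ : SpanConnected G₀ (preimage ψ Y)
    spans₀ u₀ v₀ = weaken₀ (λ _ (f∈Y , _) → ∈-preimage⁺ ψ f∈Y)
                     (lift-B-walk (λ _ → proj₂) (spans (φ u₀) (φ v₀) (φ∈V u₀) (φ∈V v₀)) refl refl)
    acyclic₀ : Acyclic G₀ (preimage ψ Y)
    acyclic₀ f₀ f₀∈ cycle₀ = acyclic (ψ f₀) (∈-preimage⁻ ψ f₀∈) (ψ∈B f₀)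
      (subst₂ (Reach G _) (sym (cong proj₁ (ends-ψ f₀))) (sym (cong proj₂ (ends-ψ f₀)))
        (map-walk (λ g₀ (g₀∈ , g₀≢f₀) → (∈-preimage⁻ ψ g₀∈ , ψ∈B g₀) , g₀≢f₀ ∘ ψ-injective _ _) cycle₀))

  spanningTree-split₀ : ∀ {Y} → IsSpanningTree G Y → IsSpanningTree G₀ (preimage ψ Y) × IsPendantForest (Y ─ B)
  spanningTree-split₀ tree with spanningTree-split tree
  ... | block-tree , forest = blockSpanningTree⁻ block-tree , forest

  spanningTree-glue₀ : ∀ {Y} → IsSpanningTree G₀ (preimage ψ Y) → IsPendantForest (Y ─ B) → IsSpanningTree G Y
  spanningTree-glue₀ tree₀ forest = spanningTree-glue (blockSpanningTree⁺ tree₀) forest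

  ─B-preimage-injective : ∀ {S T} → S ─ B ≡ T ─ B → preimage ψ S ≡ preimage ψ T → S ≡ T
  ─B-preimage-injective eq₁ eq₂ = ⊆-antisym (included eq₁ eq₂) (included (sym eq₁) (sym eq₂))
    where
    included : ∀ {S T} → S ─ B ≡ T ─ B → preimage ψ S ≡ preimage ψ T → S ⊆ T
    included eq₁ eq₂ {f} f∈S with f ∈? B
    ... | no f∉B = ∈-off-B eq₁ f∉B f∈S
    ... | yes f∈B with ψ-onto-B f f∈B
    ...   | f₀ , refl = ∈-preimage⁻ ψ (subst (f₀ ∈_) eq₂ (∈-preimage⁺ ψ f∈S))

  module _ {X : Subset (ne G)} (X∩B≡∅ : ∀ f → f ∈ X → f ∉ B) (T₀ : Subset (ne G₀)) where

    ∪image-─B : (X ∪ image ψ T₀) ─ B ≡ X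
    ∪image-─B = ⊆-antisym forth back
      where
      forth : (X ∪ image ψ T₀) ─ B ⊆ X
      forth f∈ with x∈p∪q⁻ X _ (p─q⊆p _ B f∈)
      ... | inj₁ f∈X = f∈X
      ... | inj₂ f∈T₀ with ∈-image⁻ ψ f∈T₀
      ...   | f₀ , refl , _ = ⊥-elim (x∈p─q⇒x∉q f∈ (ψ∈B f₀))
      back : X ⊆ (X ∪ image ψ T₀) ─ B
      back f∈X = x∈p∧x∉q⇒x∈p─q (x∈p∪q⁺ (inj₁ f∈X)) (X∩B≡∅ _ f∈X)

    preimage-∪image : preimage ψ (X ∪ image ψ T₀) ≡ T₀
    preimage-∪image = ⊆-antisym forth back
      where
      forth : preimage ψ (X ∪ image ψ T₀) ⊆ T₀
      forth {f₀} f₀∈ with x∈p∪q⁻ X _ (∈-preimage⁻ ψ f₀∈)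
      ... | inj₁ ψf₀∈X = ⊥-elim (X∩B≡∅ _ ψf₀∈X (ψ∈B f₀))
      ... | inj₂ ψf₀∈T₀ with ∈-image⁻ ψ ψf₀∈T₀
      ...   | g₀ , ψg₀≡ψf₀ , g₀∈ = subst (_∈ T₀) (ψ-injective _ _ ψg₀≡ψf₀) g₀∈
      back : T₀ ⊆ preimage ψ (X ∪ image ψ T₀)
      back f₀∈ = ∈-preimage⁺ ψ (x∈p∪q⁺ (inj₂ (∈-image⁺ ψ f₀∈)))

  module _ {e₀ : Fin (ne G₀)} (ψe₀≡e : ψ e₀ ≡ e) where

    private
      e-end₁ : proj₁ (ends G e) ≡ φ (proj₁ (ends G₀ e₀))
      e-end₁ = trans (cong (λ f → proj₁ (ends G f)) (sym ψe₀≡e)) (cong proj₁ (ends-ψ e₀))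
      e-end₂ : proj₂ (ends G e) ≡ φ (proj₂ (ends G₀ e₀))
      e-end₂ = trans (cong (λ f → proj₂ (ends G f)) (sym ψe₀≡e)) (cong proj₂ (ends-ψ e₀))

    InG'₀ : InG' G₀ e₀
    InG'₀ = connected₀ , series-parallel₀ , not-bridge₀ , not-loop₀
      where
      connected₀ : Connected G₀
      connected₀ u₀ v₀ = weaken₀ (λ _ _ → tt)
        (lift-B-walk (λ _ → proj₂) (walk-within-block (φ∈V u₀) (φ∈V v₀) (proj₁ inG′ (φ u₀) (φ v₀))) refl refl)
      series-parallel₀ : SeriesParallel G₀
      series-parallel₀ = proj₁ (proj₂ inG′) ∘ K4-minor-image φ-injective
      not-bridge₀ : ¬ IsBridge G₀ e₀
      not-bridge₀ bridge₀ = proj₁ (proj₂ (proj₂ inG′)) λ detour → bridge₀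
        (weaken₀ (λ _ (g≢e , _) g≡e₀ → g≢e (trans (cong ψ g≡e₀) ψe₀≡e))
          (lift-B-walk (λ _ → proj₂)
            (walk-within-block (Joins⇒InVˡ e∈B (Joins-ends e)) (Joins⇒InVʳ e∈B (Joins-ends e)) detour)
            e-end₁ e-end₂))
      not-loop₀ : ¬ IsLoop G₀ e₀
      not-loop₀ loop₀ = proj₂ (proj₂ (proj₂ inG′)) (trans e-end₁ (trans (cong φ loop₀) (sym e-end₂)))

    preimage-∪e : ∀ S → preimage ψ (S ∪ ⁅ e ⁆) ≡ preimage ψ S ∪ ⁅ e₀ ⁆
    preimage-∪e S = ⊆-antisym forth back
      where
      forth : preimage ψ (S ∪ ⁅ e ⁆) ⊆ preimage ψ S ∪ ⁅ e₀ ⁆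
      forth {f₀} f₀∈ with x∈p∪q⁻ S ⁅ e ⁆ (∈-preimage⁻ ψ f₀∈)
      ... | inj₁ ψf₀∈S = x∈p∪q⁺ (inj₁ (∈-preimage⁺ ψ ψf₀∈S))
      ... | inj₂ ψf₀∈e = x∈p∪q⁺ (inj₂ (subst (_∈ ⁅ e₀ ⁆)
                           (ψ-injective _ _ (trans ψe₀≡e (sym (x∈⁅y⁆⇒x≡y e ψf₀∈e)))) (x∈⁅x⁆ e₀)))
      back : preimage ψ S ∪ ⁅ e₀ ⁆ ⊆ preimage ψ (S ∪ ⁅ e ⁆)
      back {f₀} f₀∈ with x∈p∪q⁻ (preimage ψ S) ⁅ e₀ ⁆ f₀∈
      ... | inj₁ f₀∈S = ∈-preimage⁺ ψ (x∈p∪q⁺ (inj₁ (∈-preimage⁻ ψ f₀∈S)))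
      ... | inj₂ f₀∈e₀ = ∈-preimage⁺ ψ (x∈p∪q⁺ (inj₂ (subst (_∈ ⁅ e ⁆)
                           (sym (trans (cong ψ (x∈⁅y⁆⇒x≡y e₀ f₀∈e₀)) ψe₀≡e)) (x∈⁅x⁆ e))))

    ∪e-─B : ∀ S → (S ∪ ⁅ e ⁆) ─ B ≡ S ─ B
    ∪e-─B S = ⊆-antisym forth back
      where
      forth : (S ∪ ⁅ e ⁆) ─ B ⊆ S ─ B
      forth f∈ with x∈p∪q⁻ S ⁅ e ⁆ (p─q⊆p _ B f∈)
      ... | inj₁ f∈S = x∈p∧x∉q⇒x∈p─q f∈S (x∈p─q⇒x∉q f∈)
      ... | inj₂ f∈e = ⊥-elim (x∈p─q⇒x∉q f∈ (subst (_∈ B) (sym (x∈⁅y⁆⇒x≡y e f∈e)) e∈B))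
      back : S ─ B ⊆ (S ∪ ⁅ e ⁆) ─ B
      back f∈ = x∈p∧x∉q⇒x∈p─q (x∈p∪q⁺ (inj₁ (p─q⊆p S B f∈))) (x∈p─q⇒x∉q f∈)

    InH-split : ∀ {S} → InH G e S → InH G₀ e₀ (preimage ψ S) × IsPendantForest (S ─ B)
    InH-split {S} (e∉S , trees) = (e∉S ∘ subst (_∈ S) ψe₀≡e ∘ ∈-preimage⁻ ψ , proj₁ (split trees)) , proj₂ (split trees)
      where
      split : IsSpanningTree G (S ∪ ⁅ e ⁆) ⊎ IsSpanningTree G S →
              (IsSpanningTree G₀ (preimage ψ S ∪ ⁅ e₀ ⁆) ⊎ IsSpanningTree G₀ (preimage ψ S)) × IsPendantForest (S ─ B)
      split (inj₁ tree) with spanningTree-split₀ tree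
      ... | tree₀ , forest = inj₁ (subst (IsSpanningTree G₀) (preimage-∪e S) tree₀) , subst IsPendantForest (∪e-─B S) forest
      split (inj₂ tree) with spanningTree-split₀ tree
      ... | tree₀ , forest = inj₂ tree₀ , forest

    InH-glue : ∀ {S} → e ∉ S → InH G₀ e₀ (preimage ψ S) → IsPendantForest (S ─ B) → InH G e S
    InH-glue {S} e∉S (_ , inj₁ tree₀) forest =
      e∉S , inj₁ (spanningTree-glue₀ (subst (IsSpanningTree G₀) (sym (preimage-∪e S)) tree₀)
                                     (subst IsPendantForest (sym (∪e-─B S)) forest))
    InH-glue e∉S (_ , inj₂ tree₀) forest = e∉S , inj₂ (spanningTree-glue₀ tree₀ forest)

    copyOf : Subset (ne G) → Fin pendantForestCount × Subset (ne G₀)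
    copyOf S = forestIndex (S ─ B) , preimage ψ S

    copyOf-injective : ∀ S T → InH G e S → InH G e T → copyOf S ≡ copyOf T → S ≡ T
    copyOf-injective S T S∈H T∈H eq = ─B-preimage-injective
      (forestIndex-injective (proj₂ (InH-split S∈H)) (proj₂ (InH-split T∈H)) (cong proj₁ eq)) (cong proj₂ eq)

    copyOf-surjective : ∀ i T₀ → InH G₀ e₀ T₀ → ∃[ S ] (InH G e S × copyOf S ≡ (i , T₀))
    copyOf-surjective i T₀ T₀∈H = S , InH-glue e∉S (subst (InH G₀ e₀) (sym preimage-S) T₀∈H) forest ,
                                  cong₂ _,_ (trans (cong forestIndex S─B) (forestIndex-lookup i)) preimage-S
      where
      X : Subset (ne G)
      X = lookup pendantForests i
      forest-X : IsPendantForest X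
      forest-X = lookup-pendantForests i
      S : Subset (ne G)
      S = X ∪ image ψ T₀
      S─B : S ─ B ≡ X
      S─B = ∪image-─B (proj₁ forest-X) T₀
      preimage-S : preimage ψ S ≡ T₀
      preimage-S = preimage-∪image (proj₁ forest-X) T₀
      forest : IsPendantForest (S ─ B)
      forest = subst IsPendantForest (sym S─B) forest-X
      e∉S : e ∉ S
      e∉S e∈S = proj₁ T₀∈H (subst (e₀ ∈_) preimage-S (∈-preimage⁺ ψ (subst (_∈ S) (sym ψe₀≡e) e∈S)))

    CubeAdj⇒copies-adjacent : ∀ {S T} → InH G e S → InH G e T → CubeAdj S T →
                              proj₁ (copyOf S) ≡ proj₁ (copyOf T) × CubeAdj (preimage ψ S) (preimage ψ T)
    CubeAdj⇒copies-adjacent {S} {T} S∈H T∈H (f , S→T , ¬S→T , agree) with f ∈? B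
    ... | no f∉B =
      ⊥-elim (CubeAdj-off-B-impossible (proj₂ (InH-split S∈H)) (proj₂ (InH-split T∈H)) f∉B S→T ¬S→T agree)
    ... | yes f∈B with ψ-onto-B f f∈B
    ...   | f₀ , refl =
      cong forestIndex (─B-agree (λ g g∉B → proj₁ (agree g (≢ψf₀ g∉B))) (λ g g∉B → proj₂ (agree g (≢ψf₀ g∉B)))) ,
      f₀ , (λ f₀∈S f₀∈T → S→T (∈-preimage⁻ ψ f₀∈S) (∈-preimage⁻ ψ f₀∈T)) ,
           (λ f₀∉S → ∈-preimage⁺ ψ (¬S→T (f₀∉S ∘ ∈-preimage⁺ ψ))) ,
           λ g₀ g₀≢f₀ → let (forth , back) = agree (ψ g₀) (g₀≢f₀ ∘ ψ-injective _ _)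
                        in ∈-preimage⁺ ψ ∘ forth ∘ ∈-preimage⁻ ψ , ∈-preimage⁺ ψ ∘ back ∘ ∈-preimage⁻ ψ
      where
      ≢ψf₀ : ∀ {g} → g ∉ B → g ≢ ψ f₀
      ≢ψf₀ g∉B g≡ψf₀ = g∉B (subst (_∈ B) (sym g≡ψf₀) f∈B)

    copies-adjacent⇒CubeAdj : ∀ {S T} → InH G e S → InH G e T →
                              proj₁ (copyOf S) ≡ proj₁ (copyOf T) × CubeAdj (preimage ψ S) (preimage ψ T) → CubeAdj S T
    copies-adjacent⇒CubeAdj {S} {T} S∈H T∈H (same-forest , f₀ , S→T , ¬S→T , agree) =
      ψ f₀ , (λ ψf₀∈S ψf₀∈T → S→T (∈-preimage⁺ ψ ψf₀∈S) (∈-preimage⁺ ψ ψf₀∈T)) ,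
             (λ ψf₀∉S → ∈-preimage⁻ ψ (¬S→T (ψf₀∉S ∘ ∈-preimage⁻ ψ))) , agree′
      where
      S─B≡T─B : S ─ B ≡ T ─ B
      S─B≡T─B = forestIndex-injective (proj₂ (InH-split S∈H)) (proj₂ (InH-split T∈H)) same-forest
      agree′ : ∀ g → g ≢ ψ f₀ → (g ∈ S → g ∈ T) × (g ∈ T → g ∈ S)
      agree′ g g≢ψf₀ with g ∈? B
      ... | no g∉B = ∈-off-B S─B≡T─B g∉B , ∈-off-B (sym S─B≡T─B) g∉B
      ... | yes g∈B with ψ-onto-B g g∈B
      ...   | g₀ , refl = let (forth , back) = agree g₀ (g≢ψf₀ ∘ cong ψ)
                          in ∈-preimage⁻ ψ ∘ forth ∘ ∈-preimage⁺ ψ , ∈-preimage⁻ ψ ∘ back ∘ ∈-preimage⁺ ψ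

    isoToCopies : IsoToCopies G e pendantForestCount G₀ e₀
    isoToCopies = copyOf , (λ S S∈H → proj₁ (InH-split S∈H)) , copyOf-injective , copyOf-surjective ,
                  λ S T S∈H T∈H → CubeAdj⇒copies-adjacent S∈H T∈H , copies-adjacent⇒CubeAdj S∈H T∈H

proposition4p5 : (G : Multigraph) (e : Fin (ne G)) → InG' G e →
    (B : Subset (ne G)) → IsBlock G B → e ∈ B →
    (G₀ : Multigraph) (φ : Fin (nv G₀) → Fin (nv G)) (ψ : Fin (ne G₀) → Fin (ne G)) →
    IsSubgraphOn G B G₀ φ ψ → (e₀ : Fin (ne G₀)) → ψ e₀ ≡ e →
    InG' G₀ e₀ × ∃[ k ] IsoToCopies G e k G₀ e₀
proposition4p5 G e inG′ B isB e∈B G₀ φ ψ sub e₀ ψe₀≡e =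
  InG'₀ ψe₀≡e , pendantForestCount , isoToCopies ψe₀≡e
  where open BlockPresentation G inG′ isB e∈B sub
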